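{- Let $G$ and $\tilde G$ be caterpillar graphs of the same diameter $k+1$ (with $k\ge1$), let $h=\operatorname{aux}(\phi(G))$ and $\tilde h=\operatorname{aux}(\phi(\tilde G))$, and let $S\subseteq[k]$ with $|S|\ge2$. If $D_U(h)=D_U(\tilde h)$ for every finite nonempty $U\subset\mathbb{Z}$ with $U\prec S$, then $d(T(D_S(h)))_{degen}=d(T(D_S(\tilde h)))_{degen}$.
   Context: $\mathbb{N}$ includes $0$. A caterpillar is a tree whose removal of all leaves leaves a path. For a caterpillar $G$ of diameter $k+1$, fix a longest path $v_1,\dots,v_{k+2}$ and set $\phi(G):[k]\to\mathbb{N}$, $\phi(G)(i)=\deg(v_{i+1})-2$. For $f:[k]\to\mathbb{N}$, $\operatorname{aux}(f)$ is $h:\{0,\dots,k+1\}\to\mathbb{Z}$ with $h(0)=h(k+1)=-1$ and $h|_{[k]}=f$. For a function $u$ on an integer interval $\{a,\dots,b\}$, its reversal is $u'(i)=u(a+b-i)$; for finite nonempty $S\subset\mathbb{Z}$ with elements $S_1<\dots<S_{|S|}$ contained in the domain, $u|_S:[|S|]\to\mathbb{Z}$, $i\mapsto u(S_i)$. The $S$-deck $D_S(u)$ is the multiset in which $g$ has multiplicity $\sum_{i\in\mathbb{Z}}\big(I(i+S\subseteq\operatorname{dom}u,\ u|_{i+S}=g)+I(i+S\subseteq\operatorname{dom}u',\ u'|_{i+S}=g)\big)$. Width: $\Delta(S)=\max S-\min S+1$; $U\prec S$ means $\Delta(U)<\Delta(S)$ and $|U|\le|S|$. For $g:[s]\to\mathbb{Z}$,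 $T(g)$ increases $g(1)$ and $g(s)$ by $1$ each (if $s=1$, $T(g)(1)=g(1)+2$); $T(M)$ applies $T$ to each element of a multiset $M$. $F(c,g)=\prod_t\binom{c(t)}{g(t)}$; $d(M)$ is the multiset in which each $g\in\mathbb{N}^s$ has multiplicity $\sum_{c\in M}F(c,g)$. $g\in\mathbb{N}^s$ is degenerate if $g(1)=0$ or $g(s)=0$, and $M_{degen}$ is the submultiset of degenerate elements of $M$. -}

module Defs where

open import Data.Bool using (Bool; true; false; if_then_else_)
open import Data.Nat as ℕ using (ℕ; zero; suc; _∸_)
open import Data.Nat.Combinatorics using (_C_)
open import Data.Integer as ℤ using (ℤ; +_; -[1+_])
open import Data.Fin as Fin using (Fin; toℕ; inject₁; fromℕ)
open import Data.Fin.Properties using () renaming (_≟_ to _≟ᶠ_)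
open import Data.Vec as Vec using (Vec; []; _∷_; _∷ʳ_; tabulate; head; last; reverse)
open import Data.List as List using (List; allFin; mapMaybe; _++_)
open import Data.Nat.ListAction using (sum)
open import Data.Maybe using (Maybe; just; nothing)
open import Data.Product using (Σ; ∃; ∃-syntax; _×_; _,_)
open import Data.Sum using (_⊎_)
open import Data.Empty using (⊥)
open import Relation.Nullary using (¬_; Dec; yes; no)
open import Relation.Nullary.Decidable using (_⊎-dec_)
open import Relation.Binary.PropositionalEquality using (_≡_)
open import Function.Bundles using (_⇔_)

record Graph : Set where
  field
    n      : ℕ
    adj    : Fin n → Fin n → Bool
    sym    : ∀ u v → adj u v ≡ adj v u
    irrefl : ∀ v → adj v v ≡ false
open Graph public

deg : (G : Graph) → Fin (n G) → ℕ
deg G v = sum (List.map (λ w → if adj G v w then 1 else 0) (allFin (n G)))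

record Path (G : Graph) (m : ℕ) : Set where
  field
    vtx  : Fin (suc m) → Fin (n G)
    inj  : ∀ i j → vtx i ≡ vtx j → i ≡ j
    step : ∀ (i : Fin m) → adj G (vtx (inject₁ i)) (vtx (Fin.suc i)) ≡ true
open Path public

start end : ∀ {G m} → Path G m → Fin (n G)
start p = vtx p Fin.zero
end {m = m} p = vtx p (fromℕ m)

PathFromTo : (G : Graph) → Fin (n G) → Fin (n G) → ℕ → Set
PathFromTo G u v m = Σ (Path G m) λ p → (start p ≡ u) × (end p ≡ v)

Connected : Graph → Set
Connected G = ∀ u v → ∃[ m ] PathFromTo G u v m

Acyclic : Graph → Set
Acyclic G = ∀ m (p : Path G (suc (suc m))) → adj G (end p) (start p) ≡ false

IsTree : Graph → Set
IsTree G = Connected G × Acyclic G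

IsLeaf : (G : Graph) → Fin (n G) → Set
IsLeaf G v = deg G v ≡ 1

-- a tree such that the (induced) graph left after removing all leaves is a
-- path: some path of G runs through exactly the non-leaf vertices
IsCaterpillar : Graph → Set
IsCaterpillar G = IsTree G ×
  (∃[ m ] Σ (Path G m) λ q → ∀ v → (¬ IsLeaf G v) ⇔ (∃[ i ] vtx q i ≡ v))

Dist : (G : Graph) → Fin (n G) → Fin (n G) → ℕ → Set
Dist G u v d = PathFromTo G u v d × (∀ m → PathFromTo G u v m → d ℕ.≤ m)

HasDiameter : Graph → ℕ → Set
HasDiameter G d = (∃[ u ] ∃[ v ] Dist G u v d) × (∀ u v d′ → Dist G u v d′ → d′ ℕ.≤ d)

IsLongestPath : (G : Graph) (m : ℕ) → Path G m → Set
IsLongestPath G m p = ∀ m′ → Path G m′ → m′ ℕ.≤ m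

-- φ(G) w.r.t. the longest path v₁ … v_{k+2} (= vtx p 0 … vtx p (k+1));
-- φ(G)(i) = deg(v_{i+1}) - 2 ; the argument i : Fin k stands for i+1 ∈ [k]
phi : (G : Graph) (k : ℕ) → Path G (suc k) → Fin k → ℕ
phi G k p i = deg G (vtx p (Fin.suc (inject₁ i))) ∸ 2

-- functions on integer intervals {0,…,N}, represented as Vec ℤ (suc N)

-1ℤ : ℤ
-1ℤ = -[1+ 0 ]

aux : (k : ℕ) → (Fin k → ℕ) → Vec ℤ (suc (suc k))
aux k f = -1ℤ ∷ (tabulate (λ i → + f i) ∷ʳ -1ℤ)

at : ∀ {N} → Vec ℤ (suc N) → ℤ → Maybe ℤ
at {N} u (+ m) with m ℕ.<? suc N
... | yes m<  = just (Vec.lookup u (Fin.fromℕ< m<))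
... | no _    = nothing
at u -[1+ _ ] = nothing

allJust : ∀ {A : Set} {s} → Vec (Maybe A) s → Maybe (Vec A s)
allJust [] = just []
allJust (nothing ∷ xs) = nothing
allJust (just x ∷ xs) with allJust xs
... | just ys = just (x ∷ ys)
... | nothing = nothing

-- finite nonempty subsets of ℤ: elements S₁ < … < S_{s}, s = suc card-1

record FinZSet : Set where
  field
    card-1 : ℕ
    elt    : Fin (suc card-1) → ℤ
    sorted : ∀ i j → i Fin.< j → elt i ℤ.< elt j
open FinZSet public

card : FinZSet → ℕ
card U = suc (card-1 U)

minE maxE : FinZSet → ℤ
minE U = elt U Fin.zero
maxE U = elt U (fromℕ (card-1 U))

width : FinZSet → ℤ
width U = maxE U ℤ.- minE U ℤ.+ + 1

_≺_ : FinZSet → FinZSet → Set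
U ≺ S = (width U ℤ.< width S) × (card U ℕ.≤ card S)

restrict : ∀ {N} → Vec ℤ (suc N) → ℤ → (U : FinZSet) → Maybe (Vec ℤ (card U))
restrict u i U = allJust (tabulate (λ t → at u (i ℤ.+ elt U t)))

-- The S-deck of u as a list (multiset).  A shift i ∈ ℤ with i+U ⊆ dom u is
-- enumerated through j = i + U₁ ∈ dom u = {0,…,N} (a bijection onto such i).
-- The reversal u' has the same domain {0,…,N}, u'(i) = u(N - i).
deck : ∀ {N} → (U : FinZSet) → Vec ℤ (suc N) → List (Vec ℤ (card U))
deck {N} U u =
  mapMaybe (λ j → restrict u (+ toℕ j ℤ.- minE U) U) (allFin (suc N)) ++
  mapMaybe (λ j → restrict (reverse u) (+ toℕ j ℤ.- minE U) U) (allFin (suc N))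

incLast : ∀ {s} → Vec ℤ (suc s) → Vec ℤ (suc s)
incLast (x ∷ []) = (x ℤ.+ + 1) ∷ []
incLast (x ∷ y ∷ xs) = x ∷ incLast (y ∷ xs)

T : ∀ {s} → Vec ℤ (suc s) → Vec ℤ (suc s)
T (x ∷ []) = (x ℤ.+ + 2) ∷ []
T (x ∷ y ∷ xs) = (x ℤ.+ + 1) ∷ incLast (y ∷ xs)

binomℤ : ℤ → ℕ → ℕ
binomℤ (+ c) g = c C g
binomℤ -[1+ _ ] g = 0

F : ∀ {s} → Vec ℤ s → Vec ℕ s → ℕ
F [] [] = 1
F (c ∷ cs) (g ∷ gs) = binomℤ c g ℕ.* F cs gs

-- multisets over ℕ^s given by multiplicity functions
Multiset : ℕ → Set
Multiset s = Vec ℕ s → ℕ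

d : ∀ {s} → List (Vec ℤ s) → Multiset s
d M g = sum (List.map (λ c → F c g) M)

Degenerate : ∀ {s} → Vec ℕ (suc s) → Set
Degenerate g = (head g ≡ 0) ⊎ (last g ≡ 0)

degenerate? : ∀ {s} (g : Vec ℕ (suc s)) → Dec (Degenerate g)
degenerate? g = (head g ℕ.≟ 0) ⊎-dec (last g ℕ.≟ 0)

degenPart : ∀ {s} → Multiset (suc s) → Multiset (suc s)
degenPart M g with degenerate? g
... | yes _ = M g
... | no _  = 0

_≈ₘ_ : ∀ {s} → Multiset s → Multiset s → Set
M ≈ₘ M′ = ∀ g → M g ≡ M′ g

{-# OPTIONS --safe #-}
-- For degenerate g, say g(1) = 0, the weight F(T c, g) ignores the entry c(1) as long as c(1) ≥ -1, which
-- holds for every window of h = aux(f) and of its reversal: h is -1 at both ends and ≥ 0 inside. So the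
-- g-weighted S-deck of h can be read off a U-deck for a narrower U ≺ S: drop the first element of S if the
-- second one is adjacent to it, otherwise move it one step inward. U then has one extra window, starting on
-- the frame value h(0) = -1; an indicator weight discards it, or, when |S| = 2, it contributes a constant
-- independent of h. Hence equal U-decks give equal multiplicities of g in d(T(D_S)). The case g(s) = 0 is
-- symmetric.
module Submission where

open import Defs hiding (sym)
open import Data.Nat using (ℕ; suc; _≤_)
open import Data.Integer using (+_)
open import Data.Product using (_×_; _,_)
open import Data.Fin using (Fin)
open import Data.List using (map)
open import Data.List.Relation.Binary.Permutation.Propositional using (_↭_)
open import Relation.Binary.PropositionalEquality using (_≡_)

open import Algebra.Properties.CommutativeSemigroup using (interchange)
open import Data.Nat as ℕ using (zero; z≤n; s≤s; z<s; s<s)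
import Data.Nat.Properties as ℕP
open import Data.Nat.ListAction using (sum)
open import Data.Nat.ListAction.Properties using (sum-++; sum-↭)
open import Data.Integer as ℤ using (ℤ; -[1+_]; +≤+; -≤+; -≤-; +<+)
import Data.Integer.Properties as ℤP
open import Data.Integer.Tactic.RingSolver using (solve-∀)
open import Data.Fin as Fin using (toℕ; inject₁; fromℕ)
import Data.Fin.Properties as FinP
open import Data.Fin.Relation.Unary.Top using (view; ‵fromℕ; ‵inject₁)
open import Data.Vec as Vec using (Vec; []; _∷_; _∷ʳ_; tabulate; reverse)
import Data.Vec.Properties as VecP
open import Data.Vec.Relation.Unary.All as All using (All; []; _∷_)
import Data.Vec.Relation.Unary.All.Properties as AllP
open import Data.Vec.Functional using (updateAt)
open import Data.Vec.Functional.Properties using (updateAt-updates; updateAt-minimal)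
open import Data.List as List using (List; allFin; mapMaybe)
import Data.List.Properties as ListP
import Data.List.Relation.Binary.Permutation.Propositional.Properties as PermP
open import Data.Maybe using (Maybe; just; nothing; maybe)
open import Data.Sum using (inj₁; inj₂)
open import Data.Empty using (⊥-elim)
open import Function using (_∘_)
open import Relation.Nullary using (yes; no)
open import Relation.Binary.PropositionalEquality
  using (refl; sym; trans; cong; cong₂; subst; subst₂; module ≡-Reasoning)

open ≡-Reasoning

sumBelow : ℕ → (ℕ → ℕ) → ℕ
sumBelow zero    f = 0
sumBelow (suc n) f = f 0 ℕ.+ sumBelow n (f ∘ suc)

sumBelow-suc : ∀ n f → sumBelow (suc n) f ≡ sumBelow n f ℕ.+ f n
sumBelow-suc zero    f = ℕP.+-comm (f 0) 0
sumBelow-suc (suc n) f = begin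
  f 0 ℕ.+ sumBelow (suc n) (f ∘ suc)             ≡⟨ cong (f 0 ℕ.+_) (sumBelow-suc n (f ∘ suc)) ⟩
  f 0 ℕ.+ (sumBelow n (f ∘ suc) ℕ.+ f (suc n))   ≡⟨ ℕP.+-assoc (f 0) _ _ ⟨
  sumBelow (suc n) f ℕ.+ f (suc n)               ∎

sumBelow-cong : ∀ n {f f′} → (∀ j → j ℕ.< n → f j ≡ f′ j) → sumBelow n f ≡ sumBelow n f′
sumBelow-cong zero    f≡f′ = refl
sumBelow-cong (suc n) f≡f′ =
  cong₂ ℕ._+_ (f≡f′ 0 z<s) (sumBelow-cong n (λ j j<n → f≡f′ (suc j) (s<s j<n)))

sumBelow-cons : ∀ n {f f′} c → f 0 ≡ c → (∀ j → f (suc j) ≡ f′ j) → f′ n ≡ 0 →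
  sumBelow (suc n) f ≡ c ℕ.+ sumBelow (suc n) f′
sumBelow-cons n {f} {f′} c f0≡c f∘suc≡f′ f′n≡0 = begin
  f 0 ℕ.+ sumBelow n (f ∘ suc)      ≡⟨ cong₂ ℕ._+_ f0≡c (sumBelow-cong n (λ j _ → f∘suc≡f′ j)) ⟩
  c ℕ.+ sumBelow n f′               ≡⟨ cong (c ℕ.+_) (ℕP.+-identityʳ _) ⟨
  c ℕ.+ (sumBelow n f′ ℕ.+ 0)       ≡⟨ cong (λ x → c ℕ.+ (sumBelow n f′ ℕ.+ x)) f′n≡0 ⟨
  c ℕ.+ (sumBelow n f′ ℕ.+ f′ n)    ≡⟨ cong (c ℕ.+_) (sumBelow-suc n f′) ⟨
  c ℕ.+ sumBelow (suc n) f′         ∎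

sumBelow-snoc : ∀ n {f f′} c → f n ≡ c → (∀ j → j ℕ.< n → f j ≡ f′ j) → f′ n ≡ 0 →
  sumBelow (suc n) f ≡ c ℕ.+ sumBelow (suc n) f′
sumBelow-snoc n {f} {f′} c fn≡c f≡f′ f′n≡0 = begin
  sumBelow (suc n) f                ≡⟨ sumBelow-suc n f ⟩
  sumBelow n f ℕ.+ f n              ≡⟨ cong₂ ℕ._+_ (sumBelow-cong n f≡f′) fn≡c ⟩
  sumBelow n f′ ℕ.+ c               ≡⟨ ℕP.+-comm _ c ⟩
  c ℕ.+ sumBelow n f′               ≡⟨ cong (c ℕ.+_) (ℕP.+-identityʳ _) ⟨
  c ℕ.+ (sumBelow n f′ ℕ.+ 0)       ≡⟨ cong (λ x → c ℕ.+ (sumBelow n f′ ℕ.+ x)) f′n≡0 ⟨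
  c ℕ.+ (sumBelow n f′ ℕ.+ f′ n)    ≡⟨ cong (c ℕ.+_) (sumBelow-suc n f′) ⟨
  c ℕ.+ sumBelow (suc n) f′         ∎

sum-tabulate : ∀ n (f : ℕ → ℕ) → sum (List.tabulate {n = n} (f ∘ toℕ)) ≡ sumBelow n f
sum-tabulate zero    f = refl
sum-tabulate (suc n) f = cong (f 0 ℕ.+_) (sum-tabulate n (f ∘ suc))

sum-map-allFin : ∀ n (f : ℕ → ℕ) → sum (List.map (f ∘ toℕ) (allFin n)) ≡ sumBelow n f
sum-map-allFin n f = trans (cong sum (ListP.map-tabulate {n = n} (λ i → i) (f ∘ toℕ))) (sum-tabulate n f)

sum-map-mapMaybe : ∀ {A B : Set} (w : B → ℕ) (p : A → Maybe B) xs →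
  sum (List.map w (mapMaybe p xs)) ≡ sum (List.map (maybe w 0 ∘ p) xs)
sum-map-mapMaybe w p List.[]       = refl
sum-map-mapMaybe w p (x List.∷ xs) with p x
... | just b  = cong (w b ℕ.+_) (sum-map-mapMaybe w p xs)
... | nothing = sum-map-mapMaybe w p xs

lookupℕ : ∀ {n} → Vec ℤ n → ℕ → ℤ
lookupℕ []       _       = + 0
lookupℕ (x ∷ xs) zero    = x
lookupℕ (x ∷ xs) (suc m) = lookupℕ xs m

-- The value + 0 outside the domain is junk; it is only ever read inside.
valueAt : ∀ {n} → Vec ℤ n → ℤ → ℤ
valueAt u (+ m)     = lookupℕ u m
valueAt u -[1+ _ ]  = + 0

lookup-fromℕ< : ∀ {n} (u : Vec ℤ n) {m} (m<n : m ℕ.< n) → Vec.lookup u (Fin.fromℕ< m<n) ≡ lookupℕ u m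
lookup-fromℕ< (x ∷ xs) {zero}  _   = refl
lookup-fromℕ< (x ∷ xs) {suc m} m<n = lookup-fromℕ< xs (ℕ.s<s⁻¹ m<n)

at-inside : ∀ {N} (u : Vec ℤ (suc N)) {x} → + 0 ℤ.≤ x → x ℤ.≤ + N → at u x ≡ just (valueAt u x)
at-inside {N} u {+ m} _ (+≤+ m≤N) with m ℕ.<? suc N
... | yes m<1+N = cong just (lookup-fromℕ< u m<1+N)
... | no  m≮1+N = ⊥-elim (m≮1+N (s≤s m≤N))

at-beyond : ∀ {N} (u : Vec ℤ (suc N)) {x} → + N ℤ.< x → at u x ≡ nothing
at-beyond {N} u {+ m} (+<+ N<m) with m ℕ.<? suc N
... | yes m<1+N = ⊥-elim (ℕP.<⇒≱ N<m (ℕ.s≤s⁻¹ m<1+N))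
... | no  _     = refl

allJust-tabulate-just : ∀ {A : Set} {s} {f : Fin s → Maybe A} (v : Fin s → A) →
  (∀ t → f t ≡ just (v t)) → allJust (tabulate f) ≡ just (tabulate v)
allJust-tabulate-just {s = zero}  v f≡v = refl
allJust-tabulate-just {s = suc s} v f≡v
  rewrite f≡v Fin.zero | allJust-tabulate-just (v ∘ Fin.suc) (f≡v ∘ Fin.suc) = refl

allJust-tabulate-nothing : ∀ {A : Set} {s} (f : Fin s → Maybe A) t → f t ≡ nothing →
  allJust (tabulate f) ≡ nothing
allJust-tabulate-nothing f Fin.zero    ft≡nothing rewrite ft≡nothing = refl
allJust-tabulate-nothing f (Fin.suc t) ft≡nothing with f Fin.zero
... | nothing = refl
... | just _ rewrite allJust-tabulate-nothing (f ∘ Fin.suc) t ft≡nothing = refl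

Sorted : ∀ {n} → (Fin n → ℤ) → Set
Sorted e = ∀ i j → i Fin.< j → e i ℤ.< e j

Sorted-mono : ∀ {n} {e : Fin n → ℤ} → Sorted e → ∀ {i j} → toℕ i ℕ.≤ toℕ j → e i ℤ.≤ e j
Sorted-mono {e = e} e-sorted {i} {j} i≤j with toℕ i ℕ.≟ toℕ j
... | yes i≡j = ℤP.≤-reflexive (cong e (FinP.toℕ-injective i≡j))
... | no  i≢j = ℤP.<⇒≤ (e-sorted i j (ℕP.≤∧≢⇒< i≤j i≢j))

minE≤elt : ∀ U t → minE U ℤ.≤ elt U t
minE≤elt U t = Sorted-mono (sorted U) z≤n

elt≤maxE : ∀ U t → elt U t ℤ.≤ maxE U
elt≤maxE U t = Sorted-mono (sorted U) (FinP.≤fromℕ t)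

window : ∀ {N} → Vec ℤ (suc N) → ℤ → (U : FinZSet) → Vec ℤ (card U)
window u i U = tabulate (λ t → valueAt u (i ℤ.+ elt U t))

restrict-inside : ∀ {N} (u : Vec ℤ (suc N)) {i} U →
  + 0 ℤ.≤ i ℤ.+ minE U → i ℤ.+ maxE U ℤ.≤ + N → restrict u i U ≡ just (window u i U)
restrict-inside u {i} U 0≤i+min i+max≤N = allJust-tabulate-just _ (λ t → at-inside u
  (ℤP.≤-trans 0≤i+min (ℤP.+-monoʳ-≤ i (minE≤elt U t)))
  (ℤP.≤-trans (ℤP.+-monoʳ-≤ i (elt≤maxE U t)) i+max≤N))

restrict-beyond : ∀ {N} (u : Vec ℤ (suc N)) {i} U → + N ℤ.< i ℤ.+ maxE U → restrict u i U ≡ nothing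
restrict-beyond u {i} U N<i+max =
  allJust-tabulate-nothing (λ t → at u (i ℤ.+ elt U t)) (fromℕ _) (at-beyond u N<i+max)

windowWeight : ∀ {N} (U : FinZSet) → (Vec ℤ (card U) → ℕ) → Vec ℤ (suc N) → ℤ → ℕ
windowWeight U Φ u i = maybe Φ 0 (restrict u i U)

windowWeight-inside : ∀ {N} U Φ (u : Vec ℤ (suc N)) i →
  + 0 ℤ.≤ i ℤ.+ minE U → i ℤ.+ maxE U ℤ.≤ + N → windowWeight U Φ u i ≡ Φ (window u i U)
windowWeight-inside U Φ u i lo hi = cong (maybe Φ 0) (restrict-inside u {i} U lo hi)

windowWeight-beyond : ∀ {N} U Φ (u : Vec ℤ (suc N)) i → + N ℤ.< i ℤ.+ maxE U → windowWeight U Φ u i ≡ 0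
windowWeight-beyond U Φ u i beyond = cong (maybe Φ 0) (restrict-beyond u {i} U beyond)

-- The deck indexes a translate i + U by the position j = i + min U of its first element.
positionWeight : ∀ {N} (U : FinZSet) → (Vec ℤ (card U) → ℕ) → Vec ℤ (suc N) → ℕ → ℕ
positionWeight U Φ u j = windowWeight U Φ u (+ j ℤ.- minE U)

windowSum : ∀ {N} (U : FinZSet) → (Vec ℤ (card U) → ℕ) → Vec ℤ (suc N) → ℕ
windowSum {N} U Φ u = sumBelow (suc N) (positionWeight U Φ u)

sum-map-deck : ∀ {N} U Φ (u : Vec ℤ (suc N)) →
  sum (map Φ (deck U u)) ≡ windowSum U Φ u ℕ.+ windowSum U Φ (reverse u)
sum-map-deck {N} U Φ u = begin
  sum (map Φ (deck U u))
    ≡⟨ cong sum (ListP.map-++ Φ (mapMaybe (windows u) js) (mapMaybe (windows (reverse u)) js)) ⟩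
  sum (map Φ (mapMaybe (windows u) js) List.++ map Φ (mapMaybe (windows (reverse u)) js))
    ≡⟨ sum-++ (map Φ (mapMaybe (windows u) js)) _ ⟩
  sum (map Φ (mapMaybe (windows u) js)) ℕ.+ sum (map Φ (mapMaybe (windows (reverse u)) js))
    ≡⟨ cong₂ ℕ._+_ (windowSum-of u) (windowSum-of (reverse u)) ⟩
  windowSum U Φ u ℕ.+ windowSum U Φ (reverse u) ∎
  where
  js = allFin (suc N)
  windows : Vec ℤ (suc N) → Fin (suc N) → Maybe (Vec ℤ (card U))
  windows v j = restrict v (+ toℕ j ℤ.- minE U) U
  windowSum-of : ∀ v → sum (map Φ (mapMaybe (windows v) js)) ≡ windowSum U Φ v
  windowSum-of v = trans (sum-map-mapMaybe Φ (windows v) js)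
    (sum-map-allFin (suc N) (positionWeight U Φ v))

record Framed {N} (u : Vec ℤ (suc N)) : Set where
  field
    first≡-1        : valueAt u (+ 0) ≡ -1ℤ
    last≡-1         : valueAt u (+ N) ≡ -1ℤ
    interior-nonNeg : ∀ {x} → + 0 ℤ.< x → x ℤ.< + N → + 0 ℤ.≤ valueAt u x
    -1≤value        : ∀ x → -1ℤ ℤ.≤ valueAt u x
open Framed

All-∷ʳ : ∀ {P : ℤ → Set} {n} {xs : Vec ℤ n} {x} → All P xs → P x → All P (xs ∷ʳ x)
All-∷ʳ []         px = px ∷ []
All-∷ʳ (py ∷ pxs) px = py ∷ All-∷ʳ pxs px

All-reverse : ∀ {P : ℤ → Set} {n} {xs : Vec ℤ n} → All P xs → All P (reverse xs)
All-reverse {P} []                  = []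
All-reverse {P} {xs = x ∷ xs} (px ∷ pxs) =
  subst (All P) (sym (VecP.reverse-∷ x xs)) (All-∷ʳ (All-reverse pxs) px)

lookupℕ-All : ∀ {P : ℤ → Set} {n} {xs : Vec ℤ n} → All P xs → P (+ 0) → ∀ m → P (lookupℕ xs m)
lookupℕ-All []         p0 _       = p0
lookupℕ-All (px ∷ pxs) p0 zero    = px
lookupℕ-All (px ∷ pxs) p0 (suc m) = lookupℕ-All pxs p0 m

lookupℕ-∷ʳ-last : ∀ {n} (xs : Vec ℤ n) x → lookupℕ (xs ∷ʳ x) n ≡ x
lookupℕ-∷ʳ-last []       x = refl
lookupℕ-∷ʳ-last (y ∷ xs) x = lookupℕ-∷ʳ-last xs x

lookupℕ-∷ʳ-< : ∀ {n} (xs : Vec ℤ n) x {m} → m ℕ.< n → lookupℕ (xs ∷ʳ x) m ≡ lookupℕ xs m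
lookupℕ-∷ʳ-< (y ∷ xs) x {zero}  _         = refl
lookupℕ-∷ʳ-< (y ∷ xs) x {suc m} (s<s m<n) = lookupℕ-∷ʳ-< xs x m<n

framed-∷ʳ : ∀ {k} {ys : Vec ℤ k} → All (+ 0 ℤ.≤_) ys → Framed (-1ℤ ∷ (ys ∷ʳ -1ℤ))
framed-∷ʳ {k} {ys} ys≥0 = record
  { first≡-1        = refl
  ; last≡-1         = lookupℕ-∷ʳ-last ys -1ℤ
  ; interior-nonNeg = interior
  ; -1≤value        = bounded
  }
  where
  interior : ∀ {x} → + 0 ℤ.< x → x ℤ.< + suc k → + 0 ℤ.≤ valueAt (-1ℤ ∷ (ys ∷ʳ -1ℤ)) x
  interior {+ zero}  (+<+ ()) _
  interior {+ suc m} _ (+<+ (s<s m<k)) =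
    subst (+ 0 ℤ.≤_) (sym (lookupℕ-∷ʳ-< ys -1ℤ m<k)) (lookupℕ-All ys≥0 ℤP.≤-refl m)
  bounded : ∀ x → -1ℤ ℤ.≤ valueAt (-1ℤ ∷ (ys ∷ʳ -1ℤ)) x
  bounded (+ m)    = lookupℕ-All (ℤP.≤-refl ∷ All-∷ʳ (All.map (ℤP.≤-trans -≤+) ys≥0) ℤP.≤-refl) -≤+ m
  bounded -[1+ _ ] = -≤+

reverse-frame : ∀ {k} (ys : Vec ℤ k) → reverse (-1ℤ ∷ (ys ∷ʳ -1ℤ)) ≡ -1ℤ ∷ (reverse ys ∷ʳ -1ℤ)
reverse-frame ys = begin
  reverse (-1ℤ ∷ (ys ∷ʳ -1ℤ))     ≡⟨ VecP.reverse-∷ -1ℤ (ys ∷ʳ -1ℤ) ⟩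
  reverse (ys ∷ʳ -1ℤ) ∷ʳ -1ℤ      ≡⟨ cong (_∷ʳ -1ℤ) reverse-∷ʳ ⟩
  -1ℤ ∷ (reverse ys ∷ʳ -1ℤ)       ∎
  where
  reverse-∷ʳ : reverse (ys ∷ʳ -1ℤ) ≡ -1ℤ ∷ reverse ys
  reverse-∷ʳ = VecP.reverse-reverse (trans (VecP.reverse-∷ -1ℤ (reverse ys))
                                           (cong (_∷ʳ -1ℤ) (VecP.reverse-involutive ys)))

aux-nonNeg : ∀ k (f : Fin k → ℕ) → All (+ 0 ℤ.≤_) (tabulate (λ i → + f i))
aux-nonNeg k f = AllP.tabulate⁺ (λ _ → +≤+ z≤n)

aux-framed : ∀ k (f : Fin k → ℕ) → Framed (aux k f)
aux-framed k f = framed-∷ʳ (aux-nonNeg k f)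

reverse-aux-framed : ∀ k (f : Fin k → ℕ) → Framed (reverse (aux k f))
reverse-aux-framed k f = subst Framed (sym (reverse-frame (tabulate (λ i → + f i))))
  (framed-∷ʳ (All-reverse (aux-nonNeg k f)))

-1≤0 : -1ℤ ℤ.≤ + 0
-1≤0 = -≤+

indicatorNonNeg : ℤ → ℕ
indicatorNonNeg (+ _)    = 1
indicatorNonNeg -[1+ _ ] = 0

indicatorNonNeg-≥0 : ∀ {x} → + 0 ℤ.≤ x → indicatorNonNeg x ≡ 1
indicatorNonNeg-≥0 {+ _} _ = refl

binomℤ-suc-zero : ∀ {x} → -1ℤ ℤ.≤ x → binomℤ (x ℤ.+ + 1) 0 ≡ 1
binomℤ-suc-zero {+ _}          _          = refl
binomℤ-suc-zero { -[1+ zero ]} _          = refl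
binomℤ-suc-zero { -[1+ suc _ ]} (-≤- ())

F-T-head-irrelevant : ∀ {m x y} (cs : Vec ℤ (suc m)) (g : Vec ℕ (suc (suc m))) →
  Vec.head g ≡ 0 → -1ℤ ℤ.≤ x → -1ℤ ℤ.≤ y → F (T (x ∷ cs)) g ≡ F (T (y ∷ cs)) g
F-T-head-irrelevant (c ∷ cs) (.0 ∷ gs) refl -1≤x -1≤y =
  cong (ℕ._* F (incLast (c ∷ cs)) gs) (trans (binomℤ-suc-zero -1≤x) (sym (binomℤ-suc-zero -1≤y)))

F-incLast-last-irrelevant : ∀ {n x y} (cs : Vec ℤ n) (g : Vec ℕ (suc n)) →
  Vec.last g ≡ 0 → -1ℤ ℤ.≤ x → -1ℤ ℤ.≤ y → F (incLast (cs ∷ʳ x)) g ≡ F (incLast (cs ∷ʳ y)) g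
F-incLast-last-irrelevant []           (.0 ∷ [])     refl -1≤x -1≤y =
  cong (ℕ._* 1) (trans (binomℤ-suc-zero -1≤x) (sym (binomℤ-suc-zero -1≤y)))
F-incLast-last-irrelevant (c ∷ [])     (g₀ ∷ g₁ ∷ []) g₁≡0 -1≤x -1≤y =
  cong (binomℤ c g₀ ℕ.*_) (F-incLast-last-irrelevant [] (g₁ ∷ []) g₁≡0 -1≤x -1≤y)
F-incLast-last-irrelevant (c ∷ c′ ∷ cs) (g₀ ∷ gs)    gₗ≡0 -1≤x -1≤y =
  cong (binomℤ c g₀ ℕ.*_) (F-incLast-last-irrelevant (c′ ∷ cs) gs gₗ≡0 -1≤x -1≤y)

F-T-last-irrelevant : ∀ {m x y} (cs : Vec ℤ (suc m)) (g : Vec ℕ (suc (suc m))) →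
  Vec.last g ≡ 0 → -1ℤ ℤ.≤ x → -1ℤ ℤ.≤ y → F (T (cs ∷ʳ x)) g ≡ F (T (cs ∷ʳ y)) g
F-T-last-irrelevant (c ∷ [])      (g₀ ∷ gs) gₗ≡0 -1≤x -1≤y =
  cong (binomℤ (c ℤ.+ + 1) g₀ ℕ.*_) (F-incLast-last-irrelevant [] gs gₗ≡0 -1≤x -1≤y)
F-T-last-irrelevant (c ∷ c′ ∷ cs) (g₀ ∷ gs) gₗ≡0 -1≤x -1≤y =
  cong (binomℤ (c ℤ.+ + 1) g₀ ℕ.*_) (F-incLast-last-irrelevant (c′ ∷ cs) gs gₗ≡0 -1≤x -1≤y)

≺-raiseMin : ∀ {U S} → minE S ℤ.< minE U → maxE U ≡ maxE S → card U ℕ.≤ card S → U ≺ S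
≺-raiseMin {U} {S} min< max≡ card≤ =
  ℤP.+-monoˡ-< (+ 1) (subst (λ a → a ℤ.- minE U ℤ.< maxE S ℤ.- minE S) (sym max≡)
                            (ℤP.+-monoʳ-< (maxE S) (ℤP.neg-mono-< min<))) ,
  card≤

≺-lowerMax : ∀ {U S} → minE U ≡ minE S → maxE U ℤ.< maxE S → card U ℕ.≤ card S → U ≺ S
≺-lowerMax {U} {S} min≡ max< card≤ =
  ℤP.+-monoˡ-< (+ 1) (subst (λ a → maxE U ℤ.- a ℤ.< maxE S ℤ.- minE S) (sym min≡)
                            (ℤP.+-monoˡ-< (ℤ.- minE S) max<)) ,
  card≤

tabulate-∷ʳ : ∀ {A : Set} {n} (h : Fin (suc n) → A) → tabulate h ≡ tabulate (h ∘ inject₁) ∷ʳ h (fromℕ n)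
tabulate-∷ʳ {n = zero}  h = refl
tabulate-∷ʳ {n = suc n} h = cong (h Fin.zero ∷_) (tabulate-∷ʳ (h ∘ Fin.suc))

last-tabulate : ∀ {A : Set} {n} (h : Fin (suc n) → A) → Vec.last (tabulate h) ≡ h (fromℕ n)
last-tabulate {n = n} h =
  trans (cong (Vec.last {n = n}) (tabulate-∷ʳ h)) (VecP.last-∷ʳ (h (fromℕ n)) (tabulate (h ∘ inject₁)))

module Shrinkings {m : ℕ} (e : Fin (suc (suc m)) → ℤ) (e-sorted : Sorted e) where

  S : FinZSet
  S = record { card-1 = suc m ; elt = e ; sorted = e-sorted }

  penultimate<last : e (inject₁ (fromℕ m)) ℤ.< e (fromℕ (suc m))
  penultimate<last = e-sorted _ _ (FinP.ℕ<⇒inject₁< (ℕP.n<1+n (toℕ (fromℕ m))))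

  dropFirst : FinZSet
  dropFirst = record
    { card-1 = m ; elt = e ∘ Fin.suc ; sorted = λ i j → e-sorted (Fin.suc i) (Fin.suc j) ∘ s<s }

  dropFirst≺S : dropFirst ≺ S
  dropFirst≺S = ≺-raiseMin {dropFirst} {S} (e-sorted Fin.zero (Fin.suc Fin.zero) z<s) refl (ℕP.n≤1+n _)

  raiseFirst : ℤ.suc (e Fin.zero) ℤ.< e (Fin.suc Fin.zero) → FinZSet
  raiseFirst gap = record { card-1 = suc m ; elt = updateAt e Fin.zero ℤ.suc ; sorted = raised-sorted }
    where
    raised-sorted : Sorted (updateAt e Fin.zero ℤ.suc)
    raised-sorted Fin.zero    Fin.zero    ()
    raised-sorted Fin.zero    (Fin.suc j) _   =
      ℤP.<-≤-trans gap (Sorted-mono {e = e} e-sorted {Fin.suc Fin.zero} {Fin.suc j} (s≤s z≤n))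
    raised-sorted (Fin.suc i) Fin.zero    ()
    raised-sorted (Fin.suc i) (Fin.suc j) i<j = e-sorted (Fin.suc i) (Fin.suc j) i<j

  raiseFirst≺S : ∀ gap → raiseFirst gap ≺ S
  raiseFirst≺S gap = ≺-raiseMin {raiseFirst gap} {S} (ℤP.suc[i]≤j⇒i<j ℤP.≤-refl) refl ℕP.≤-refl

  dropLast : FinZSet
  dropLast = record { card-1 = m ; elt = e ∘ inject₁ ; sorted = λ i j i<j →
    e-sorted (inject₁ i) (inject₁ j) (subst₂ ℕ._<_ (sym (FinP.toℕ-inject₁ i)) (sym (FinP.toℕ-inject₁ j)) i<j) }

  dropLast≺S : dropLast ≺ S
  dropLast≺S = ≺-lowerMax {dropLast} {S} refl penultimate<last (ℕP.n≤1+n _)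

  lowered : Fin (suc (suc m)) → ℤ
  lowered = updateAt e (fromℕ (suc m)) ℤ.pred

  lowered-last : lowered (fromℕ (suc m)) ≡ ℤ.pred (e (fromℕ (suc m)))
  lowered-last = updateAt-updates (fromℕ (suc m)) e

  lowered-inject₁ : ∀ t → lowered (inject₁ t) ≡ e (inject₁ t)
  lowered-inject₁ t = updateAt-minimal (inject₁ t) (fromℕ (suc m)) e (FinP.fromℕ≢inject₁ ∘ sym)

  lowered≤e : ∀ i → lowered i ℤ.≤ e i
  lowered≤e i with view i
  ... | ‵fromℕ     = subst (ℤ._≤ e (fromℕ (suc m))) (sym lowered-last) (ℤP.i≤j⇒pred[i]≤j ℤP.≤-refl)
  ... | ‵inject₁ t = ℤP.≤-reflexive (lowered-inject₁ t)

  lowerLast : e (inject₁ (fromℕ m)) ℤ.< ℤ.pred (e (fromℕ (suc m))) → FinZSet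
  lowerLast gap = record { card-1 = suc m ; elt = lowered ; sorted = lowered-sorted }
    where
    lowered-sorted : Sorted lowered
    lowered-sorted i j i<j with view j
    ... | ‵fromℕ = subst₂ ℤ._<_
            (sym (updateAt-minimal i (fromℕ (suc m)) e (λ { refl → ℕP.<-irrefl refl i<j })))
            (sym lowered-last)
            (ℤP.≤-<-trans (Sorted-mono {e = e} e-sorted i≤penultimate) gap)
      where
      i≤penultimate : toℕ i ℕ.≤ toℕ (inject₁ (fromℕ m))
      i≤penultimate = subst (toℕ i ℕ.≤_) (sym (FinP.toℕ-inject₁ (fromℕ m))) (ℕ.s≤s⁻¹ i<j)
    ... | ‵inject₁ t = subst (lowered i ℤ.<_) (sym (lowered-inject₁ t))
            (ℤP.≤-<-trans (lowered≤e i) (e-sorted i (inject₁ t) i<j))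

  lowerLast≺S : ∀ gap → lowerLast gap ≺ S
  lowerLast≺S gap = ≺-lowerMax {lowerLast gap} {S} refl
    (subst (ℤ._< e (fromℕ (suc m))) (sym lowered-last) (ℤP.i≤pred[j]⇒i<j ℤP.≤-refl)) ℕP.≤-refl

  window-S : ∀ {N} (u : Vec ℤ (suc N)) i →
    window u i S ≡ window u i dropLast ∷ʳ valueAt u (i ℤ.+ e (fromℕ (suc m)))
  window-S u i = tabulate-∷ʳ (λ t → valueAt u (i ℤ.+ e t))

  window-lowerLast : ∀ {N} (u : Vec ℤ (suc N)) i gap →
    window u i (lowerLast gap) ≡ window u i dropLast ∷ʳ valueAt u (i ℤ.+ maxE (lowerLast gap))
  window-lowerLast u i gap = trans (tabulate-∷ʳ (λ t → valueAt u (i ℤ.+ lowered t)))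
    (cong (_∷ʳ valueAt u (i ℤ.+ lowered (fromℕ (suc m))))
          (VecP.tabulate-cong (λ t → cong (λ a → valueAt u (i ℤ.+ a)) (lowered-inject₁ t))))

  module _ (g : Vec ℕ (suc (suc m))) {N} {u : Vec ℤ (suc N)} (u-framed : Framed u) (i : ℤ) where

    F-T-window-dropFirst : Vec.head g ≡ 0 → F (T (+ 0 ∷ window u i dropFirst)) g ≡ F (T (window u i S)) g
    F-T-window-dropFirst g₀≡0 =
      F-T-head-irrelevant (window u i dropFirst) g g₀≡0 -1≤0 (-1≤value u-framed (i ℤ.+ e Fin.zero))

    F-T-window-dropLast : Vec.last g ≡ 0 → F (T (window u i dropLast ∷ʳ + 0)) g ≡ F (T (window u i S)) g
    F-T-window-dropLast gₗ≡0 = trans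
      (F-T-last-irrelevant (window u i dropLast) g gₗ≡0 -1≤0 (-1≤value u-framed (i ℤ.+ e (fromℕ (suc m)))))
      (cong (λ c → F (T c) g) (sym (window-S u i)))

-- Since c₀ does not depend on u, a reduction turns equal U-decks into equal w-weighted S-decks.
record Reduction (S : FinZSet) (w : Vec ℤ (card S) → ℕ) : Set where
  field
    U           : FinZSet
    U≺S         : U ≺ S
    Φ           : Vec ℤ (card U) → ℕ
    c₀          : ℕ
    windowSum-U : ∀ {N} (u : Vec ℤ (suc N)) → Framed u → windowSum U Φ u ≡ c₀ ℕ.+ windowSum S w u

x-a+a≡x : ∀ x a → x ℤ.- a ℤ.+ a ≡ x
x-a+a≡x = solve-∀

module _ {N} (u : Vec ℤ (suc N)) (S U : FinZSet) (w : Vec ℤ (card S) → ℕ) (Φ : Vec ℤ (card U) → ℕ) where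

  windowWeight-lastPosition : minE S ℤ.< maxE S → windowWeight S w u (+ N ℤ.- minE S) ≡ 0
  windowWeight-lastPosition min<max = windowWeight-beyond S w u (+ N ℤ.- minE S)
    (subst (ℤ._< (+ N ℤ.- minE S) ℤ.+ maxE S) (x-a+a≡x (+ N) (minE S))
           (ℤP.+-monoʳ-< (+ N ℤ.- minE S) min<max))

  windowSum-cons : ∀ c₀ → minE U ≡ ℤ.suc (minE S) → minE S ℤ.< maxE S →
    windowWeight U Φ u (+ 0 ℤ.- minE U) ≡ c₀ →
    (∀ i → + 0 ℤ.≤ i ℤ.+ minE S → windowWeight U Φ u i ≡ windowWeight S w u i) →
    windowSum U Φ u ≡ c₀ ℕ.+ windowSum S w u
  windowSum-cons c₀ min-U min<max first≡c₀ agree =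
    sumBelow-cons N {positionWeight U Φ u} {positionWeight S w u} c₀ first≡c₀ shifted
      (windowWeight-lastPosition min<max)
    where
    suc-x-suc-a : ∀ x a → (+ 1 ℤ.+ x) ℤ.- (+ 1 ℤ.+ a) ≡ x ℤ.- a
    suc-x-suc-a = solve-∀
    shifted : ∀ j → windowWeight U Φ u (+ suc j ℤ.- minE U) ≡ windowWeight S w u (+ j ℤ.- minE S)
    shifted j = trans
      (cong (windowWeight U Φ u) (trans (cong (λ a → + suc j ℤ.- a) min-U) (suc-x-suc-a (+ j) (minE S))))
      (agree (+ j ℤ.- minE S) (subst (+ 0 ℤ.≤_) (sym (x-a+a≡x (+ j) (minE S))) (+≤+ z≤n)))

  windowSum-snoc : ∀ c₀ → minE U ≡ minE S → minE S ℤ.< maxE S →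
    windowWeight U Φ u (+ N ℤ.- minE S) ≡ c₀ →
    (∀ j → j ℕ.< N → windowWeight U Φ u (+ j ℤ.- minE S) ≡ windowWeight S w u (+ j ℤ.- minE S)) →
    windowSum U Φ u ≡ c₀ ℕ.+ windowSum S w u
  windowSum-snoc c₀ min-U min<max last≡c₀ agree = trans
    (sumBelow-cong (suc N) (λ j _ → cong (λ a → windowWeight U Φ u (+ j ℤ.- a)) min-U))
    (sumBelow-snoc N {f′ = positionWeight S w u} c₀ last≡c₀ agree (windowWeight-lastPosition min<max))

  windowWeight-sameMax : minE S ℤ.≤ minE U → maxE U ≡ maxE S → ∀ {i} → + 0 ℤ.≤ i ℤ.+ minE S →
    (i ℤ.+ maxE S ℤ.≤ + N → Φ (window u i U) ≡ w (window u i S)) →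
    windowWeight U Φ u i ≡ windowWeight S w u i
  windowWeight-sameMax min≤ max≡ {i} lo agree with i ℤ.+ maxE S ℤ.≤? + N
  ... | yes fits = trans
    (windowWeight-inside U Φ u i (ℤP.≤-trans lo (ℤP.+-monoʳ-≤ i min≤))
                                 (subst (λ a → i ℤ.+ a ℤ.≤ + N) (sym max≡) fits))
    (trans (agree fits) (sym (windowWeight-inside S w u i lo fits)))
  ... | no ¬fits = trans
    (windowWeight-beyond U Φ u i (subst (λ a → + N ℤ.< i ℤ.+ a) (sym max≡) (ℤP.≰⇒> ¬fits)))
    (sym (windowWeight-beyond S w u i (ℤP.≰⇒> ¬fits)))

  indicator-interior : Framed u → ∀ x → + 0 ℤ.< x → x ℤ.< + N → ∀ n →
    indicatorNonNeg (valueAt u x) ℕ.* n ≡ n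
  indicator-interior u-framed x 0<x x<N n =
    trans (cong (ℕ._* n) (indicatorNonNeg-≥0 (interior-nonNeg u-framed 0<x x<N))) (ℕP.*-identityˡ n)

  indicator-frame : ∀ x → valueAt u x ≡ -1ℤ → ∀ n → indicatorNonNeg (valueAt u x) ℕ.* n ≡ 0
  indicator-frame x u[x]≡-1 n = cong (λ y → indicatorNonNeg y ℕ.* n) u[x]≡-1

  -- U has one window more than S, the one starting on the frame value u(0) = -1; the indicator kills it
  -- and is 1 on every other window.
  module WideHead (u-framed : Framed u) (min-U : minE U ≡ ℤ.suc (minE S)) (max-U : maxE U ≡ maxE S)
                  (wide : ℤ.suc (minE S) ℤ.< maxE S)
                  (Φ-window : ∀ i → Φ (window u i U) ≡
                                     indicatorNonNeg (valueAt u (i ℤ.+ minE U)) ℕ.* w (window u i S)) where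

    firstWeight≡0 : windowWeight U Φ u (+ 0 ℤ.- minE U) ≡ 0
    firstWeight≡0 with (+ 0 ℤ.- minE U) ℤ.+ maxE U ℤ.≤? + N
    ... | yes fits = begin
      windowWeight U Φ u i₀  ≡⟨ windowWeight-inside U Φ u i₀ (ℤP.≤-reflexive (sym i₀+minU≡0)) fits ⟩
      Φ (window u i₀ U)      ≡⟨ Φ-window i₀ ⟩
      _                      ≡⟨ indicator-frame (i₀ ℤ.+ minE U)
                                  (trans (cong (valueAt u) i₀+minU≡0) (first≡-1 u-framed)) _ ⟩
      0                      ∎
      where
      i₀ = + 0 ℤ.- minE U
      i₀+minU≡0 : i₀ ℤ.+ minE U ≡ + 0
      i₀+minU≡0 = x-a+a≡x (+ 0) (minE U)
    ... | no ¬fits = windowWeight-beyond U Φ u (+ 0 ℤ.- minE U) (ℤP.≰⇒> ¬fits)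

    weights-agree : ∀ i → + 0 ℤ.≤ i ℤ.+ minE S → windowWeight U Φ u i ≡ windowWeight S w u i
    weights-agree i lo = windowWeight-sameMax (ℤP.<⇒≤ minS<minU) max-U {i} lo λ fits →
      trans (Φ-window i) (indicator-interior u-framed (i ℤ.+ minE U) (ℤP.≤-<-trans lo (ℤP.+-monoʳ-< i minS<minU))
        (ℤP.<-≤-trans (ℤP.+-monoʳ-< i (subst (ℤ._< maxE S) (sym min-U) wide)) fits) _)
      where
      minS<minU : minE S ℤ.< minE U
      minS<minU = subst (minE S ℤ.<_) (sym min-U) (ℤP.suc[i]≤j⇒i<j ℤP.≤-refl)

    windowSum-reduces : windowSum U Φ u ≡ 0 ℕ.+ windowSum S w u
    windowSum-reduces =
      windowSum-cons 0 min-U (ℤP.<-trans (ℤP.suc[i]≤j⇒i<j ℤP.≤-refl) wide) firstWeight≡0 weights-agree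

  -- The windows of U that S lacks end on the frame value u(N) = -1; the indicator kills them and is 1 on
  -- every other window.
  module WideTail (u-framed : Framed u) (min-U : minE U ≡ minE S) (max-U : maxE U ≡ ℤ.pred (maxE S))
                  (wide : minE S ℤ.< ℤ.pred (maxE S))
                  (Φ-window : ∀ i → Φ (window u i U) ≡
                                     indicatorNonNeg (valueAt u (i ℤ.+ maxE U)) ℕ.* w (window u i S)) where

    maxU<maxS : maxE U ℤ.< maxE S
    maxU<maxS = subst (ℤ._< maxE S) (sym max-U) (ℤP.i≤pred[j]⇒i<j ℤP.≤-refl)

    minS<maxS : minE S ℤ.< maxE S
    minS<maxS = ℤP.<-trans wide (ℤP.i≤pred[j]⇒i<j ℤP.≤-refl)

    pred-+ : ∀ i a → -1ℤ ℤ.+ (i ℤ.+ a) ≡ i ℤ.+ (-1ℤ ℤ.+ a)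
    pred-+ = solve-∀

    weights-agree : ∀ i → + 0 ℤ.≤ i ℤ.+ minE S → windowWeight U Φ u i ≡ windowWeight S w u i
    weights-agree i lo with i ℤ.+ maxE S ℤ.≤? + N | i ℤ.+ maxE U ℤ.≤? + N
    ... | yes fits | _ = begin
      windowWeight U Φ u i  ≡⟨ windowWeight-inside U Φ u i lo-U
                                 (ℤP.≤-trans (ℤP.+-monoʳ-≤ i (ℤP.<⇒≤ maxU<maxS)) fits) ⟩
      Φ (window u i U)      ≡⟨ Φ-window i ⟩
      _                     ≡⟨ indicator-interior u-framed (i ℤ.+ maxE U)
                                 (ℤP.≤-<-trans lo (ℤP.+-monoʳ-< i (subst (minE S ℤ.<_) (sym max-U) wide)))
                                 (ℤP.<-≤-trans (ℤP.+-monoʳ-< i maxU<maxS) fits) _ ⟩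
      w (window u i S)      ≡⟨ windowWeight-inside S w u i lo fits ⟨
      windowWeight S w u i  ∎
      where
      lo-U : + 0 ℤ.≤ i ℤ.+ minE U
      lo-U = subst (λ a → + 0 ℤ.≤ i ℤ.+ a) (sym min-U) lo
    ... | no ¬fits | yes fits-U = begin
      windowWeight U Φ u i  ≡⟨ windowWeight-inside U Φ u i (subst (λ a → + 0 ℤ.≤ i ℤ.+ a) (sym min-U) lo)
                                 fits-U ⟩
      Φ (window u i U)      ≡⟨ Φ-window i ⟩
      _                     ≡⟨ indicator-frame (i ℤ.+ maxE U)
                                 (trans (cong (valueAt u) i+maxU≡N) (last≡-1 u-framed)) _ ⟩
      0                     ≡⟨ windowWeight-beyond S w u i (ℤP.≰⇒> ¬fits) ⟨
      windowWeight S w u i  ∎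
      where
      i+maxU≡N : i ℤ.+ maxE U ≡ + N
      i+maxU≡N = ℤP.≤-antisym fits-U
        (subst (+ N ℤ.≤_) (trans (pred-+ i (maxE S)) (cong (λ a → i ℤ.+ a) (sym max-U)))
               (ℤP.i<j⇒i≤pred[j] (ℤP.≰⇒> ¬fits)))
    ... | no ¬fits | no ¬fits-U =
      trans (windowWeight-beyond U Φ u i (ℤP.≰⇒> ¬fits-U)) (sym (windowWeight-beyond S w u i (ℤP.≰⇒> ¬fits)))

    windowSum-reduces : windowSum U Φ u ≡ 0 ℕ.+ windowSum S w u
    windowSum-reduces = windowSum-snoc 0 min-U minS<maxS
      (trans (weights-agree (+ N ℤ.- minE S) (lowerBound N)) (windowWeight-lastPosition minS<maxS))
      (λ j _ → weights-agree (+ j ℤ.- minE S) (lowerBound j))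
      where
      lowerBound : ∀ j → + 0 ℤ.≤ (+ j ℤ.- minE S) ℤ.+ minE S
      lowerBound j = subst (+ 0 ℤ.≤_) (sym (x-a+a≡x (+ j) (minE S))) (+≤+ z≤n)

module WideReductions {m : ℕ} (e : Fin (suc (suc m)) → ℤ) (e-sorted : Sorted e) (g : Vec ℕ (suc (suc m)))
                      (wide : ℤ.suc (e Fin.zero) ℤ.< e (fromℕ (suc m))) where
  open Shrinkings e e-sorted

  w : Vec ℤ (suc (suc m)) → ℕ
  w c = F (T c) g

  headReduction : Vec.head g ≡ 0 → Reduction S w
  headReduction g₀≡0 with e (Fin.suc Fin.zero) ℤ.≟ ℤ.suc (e Fin.zero)
  ... | yes adjacent = record
    { U           = dropFirst
    ; U≺S         = dropFirst≺S
    ; Φ           = Φ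
    ; c₀          = 0
    ; windowSum-U = λ u u-framed → WideHead.windowSum-reduces u S dropFirst w Φ u-framed adjacent refl wide
        λ i → cong (indicatorNonNeg (valueAt u (i ℤ.+ e (Fin.suc Fin.zero))) ℕ.*_)
                   (F-T-window-dropFirst g u-framed i g₀≡0)
    }
    where
    Φ : Vec ℤ (suc m) → ℕ
    Φ c = indicatorNonNeg (Vec.head c) ℕ.* F (T (+ 0 ∷ c)) g
  ... | no ¬adjacent = record
    { U           = raiseFirst gap
    ; U≺S         = raiseFirst≺S gap
    ; Φ           = Φ
    ; c₀          = 0
    ; windowSum-U = λ u u-framed → WideHead.windowSum-reduces u S (raiseFirst gap) w Φ u-framed refl refl wide
        λ i → cong (indicatorNonNeg (valueAt u (i ℤ.+ ℤ.suc (e Fin.zero))) ℕ.*_)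
                   (F-T-window-dropFirst g u-framed i g₀≡0)
    }
    where
    gap : ℤ.suc (e Fin.zero) ℤ.< e (Fin.suc Fin.zero)
    gap = ℤP.≤∧≢⇒< (ℤP.i<j⇒suc[i]≤j (e-sorted Fin.zero (Fin.suc Fin.zero) z<s)) (¬adjacent ∘ sym)
    Φ : Vec ℤ (suc (suc m)) → ℕ
    Φ c = indicatorNonNeg (Vec.head c) ℕ.* F (T (+ 0 ∷ Vec.tail c)) g

  wide′ : e Fin.zero ℤ.< ℤ.pred (e (fromℕ (suc m)))
  wide′ = ℤP.suc[i]≤j⇒i<j (ℤP.i<j⇒i≤pred[j] wide)

  tailReduction : Vec.last g ≡ 0 → Reduction S w
  tailReduction gₗ≡0 with e (inject₁ (fromℕ m)) ℤ.≟ ℤ.pred (e (fromℕ (suc m)))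
  ... | yes adjacent = record
    { U           = dropLast
    ; U≺S         = dropLast≺S
    ; Φ           = Φ
    ; c₀          = 0
    ; windowSum-U = λ u u-framed → WideTail.windowSum-reduces u S dropLast w Φ u-framed refl adjacent wide′
        λ i → cong₂ ℕ._*_ (cong indicatorNonNeg (last-tabulate (λ t → valueAt u (i ℤ.+ e (inject₁ t)))))
                          (F-T-window-dropLast g u-framed i gₗ≡0)
    }
    where
    Φ : Vec ℤ (suc m) → ℕ
    Φ c = indicatorNonNeg (Vec.last c) ℕ.* F (T (c ∷ʳ + 0)) g
  ... | no ¬adjacent = record
    { U           = lowerLast gap
    ; U≺S         = lowerLast≺S gap
    ; Φ           = Φ
    ; c₀          = 0
    ; windowSum-U = λ u u-framed →
        WideTail.windowSum-reduces u S (lowerLast gap) w Φ u-framed refl lowered-last wide′ (Φ-window u-framed)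
    }
    where
    gap : e (inject₁ (fromℕ m)) ℤ.< ℤ.pred (e (fromℕ (suc m)))
    gap = ℤP.≤∧≢⇒< (ℤP.i<j⇒i≤pred[j] penultimate<last) ¬adjacent
    Φ : Vec ℤ (suc (suc m)) → ℕ
    Φ c = indicatorNonNeg (Vec.last c) ℕ.* F (T (Vec.init c ∷ʳ + 0)) g
    Φ-window : ∀ {N} {u : Vec ℤ (suc N)} → Framed u → ∀ i → Φ (window u i (lowerLast gap)) ≡
      indicatorNonNeg (valueAt u (i ℤ.+ maxE (lowerLast gap))) ℕ.* w (window u i S)
    Φ-window {u = u} u-framed i = begin
      Φ (window u i (lowerLast gap))              ≡⟨ cong Φ (window-lowerLast u i gap) ⟩
      Φ (window u i dropLast ∷ʳ x)                ≡⟨ cong₂ ℕ._*_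
                                                       (cong indicatorNonNeg (VecP.last-∷ʳ x (window u i dropLast)))
                                                       (cong (λ c → F (T (c ∷ʳ + 0)) g)
                                                             (VecP.init-∷ʳ x (window u i dropLast))) ⟩
      indicatorNonNeg x ℕ.* F (T (window u i dropLast ∷ʳ + 0)) g
                                                  ≡⟨ cong (indicatorNonNeg x ℕ.*_) (F-T-window-dropLast g u-framed i gₗ≡0) ⟩
      indicatorNonNeg x ℕ.* w (window u i S)      ∎
      where
      x = valueAt u (i ℤ.+ maxE (lowerLast gap))

  reduction : Degenerate g → Reduction S w
  reduction (inj₁ g₀≡0) = headReduction g₀≡0
  reduction (inj₂ gₗ≡0) = tailReduction gₗ≡0

module NarrowReductions (e : Fin 2 → ℤ) (e-sorted : Sorted e) (g : Vec ℕ 2)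
                        (adjacent : e (Fin.suc Fin.zero) ≡ ℤ.suc (e Fin.zero)) where
  open Shrinkings e e-sorted

  w : Vec ℤ 2 → ℕ
  w c = F (T c) g

  e₀ e₁ : ℤ
  e₀ = e Fin.zero
  e₁ = e (Fin.suc Fin.zero)

  e₀<e₁ : e₀ ℤ.< e₁
  e₀<e₁ = e-sorted Fin.zero (Fin.suc Fin.zero) z<s

  -- The window of {e₁} at the frame position 0 has no counterpart in S; it contributes the constant c₀.
  headReduction : Vec.head g ≡ 0 → Reduction S w
  headReduction g₀≡0 = record
    { U           = dropFirst
    ; U≺S         = dropFirst≺S
    ; Φ           = Φ
    ; c₀          = F (T (+ 0 ∷ -1ℤ ∷ [])) g
    ; windowSum-U = λ u u-framed → windowSum-cons u S dropFirst w Φ _ adjacent e₀<e₁ (firstWeight u-framed)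
        λ i lo → windowWeight-sameMax u S dropFirst w Φ (ℤP.<⇒≤ e₀<e₁) refl {i} lo
          λ _ → F-T-window-dropFirst g u-framed i g₀≡0
    }
    where
    Φ : Vec ℤ 1 → ℕ
    Φ c = F (T (+ 0 ∷ c)) g
    firstWeight : ∀ {N} {u : Vec ℤ (suc N)} → Framed u →
      windowWeight dropFirst Φ u (+ 0 ℤ.- e₁) ≡ F (T (+ 0 ∷ -1ℤ ∷ [])) g
    firstWeight {u = u} u-framed = begin
      windowWeight dropFirst Φ u i₀              ≡⟨ windowWeight-inside dropFirst Φ u i₀ (ℤP.≤-reflexive (sym at0))
                                                       (subst (ℤ._≤ _) (sym at0) (+≤+ z≤n)) ⟩
      F (T (+ 0 ∷ valueAt u (i₀ ℤ.+ e₁) ∷ [])) g ≡⟨ cong (λ x → F (T (+ 0 ∷ x ∷ [])) g)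
                                                       (trans (cong (valueAt u) at0) (first≡-1 u-framed)) ⟩
      F (T (+ 0 ∷ -1ℤ ∷ [])) g                   ∎
      where
      i₀ = + 0 ℤ.- e₁
      at0 : i₀ ℤ.+ e₁ ≡ + 0
      at0 = x-a+a≡x (+ 0) e₁

  -- The window of {e₀} at the frame position N has no counterpart in S; it contributes the constant c₀.
  tailReduction : Vec.last g ≡ 0 → Reduction S w
  tailReduction gₗ≡0 = record
    { U           = dropLast
    ; U≺S         = dropLast≺S
    ; Φ           = Φ
    ; c₀          = F (T (-1ℤ ∷ + 0 ∷ [])) g
    ; windowSum-U = λ u u-framed →
        windowSum-snoc u S dropLast w Φ _ refl e₀<e₁ (lastWeight u-framed) (agree u-framed)
    }
    where
    Φ : Vec ℤ 1 → ℕ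
    Φ c = F (T (c ∷ʳ + 0)) g
    lastWeight : ∀ {N} {u : Vec ℤ (suc N)} → Framed u →
      windowWeight dropLast Φ u (+ N ℤ.- e₀) ≡ F (T (-1ℤ ∷ + 0 ∷ [])) g
    lastWeight {N} {u} u-framed = begin
      windowWeight dropLast Φ u i                ≡⟨ windowWeight-inside dropLast Φ u i
                                                       (subst (+ 0 ℤ.≤_) (sym atN) (+≤+ z≤n)) (ℤP.≤-reflexive atN) ⟩
      F (T (valueAt u (i ℤ.+ e₀) ∷ + 0 ∷ [])) g ≡⟨ cong (λ x → F (T (x ∷ + 0 ∷ [])) g)
                                                       (trans (cong (valueAt u) atN) (last≡-1 u-framed)) ⟩
      F (T (-1ℤ ∷ + 0 ∷ [])) g                   ∎
      where
      i = + N ℤ.- e₀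
      atN : i ℤ.+ e₀ ≡ + N
      atN = x-a+a≡x (+ N) e₀
    i+suc : ∀ i a → i ℤ.+ (+ 1 ℤ.+ a) ≡ + 1 ℤ.+ (i ℤ.+ a)
    i+suc = solve-∀
    agree : ∀ {N} {u : Vec ℤ (suc N)} → Framed u → ∀ j → j ℕ.< N →
      windowWeight dropLast Φ u (+ j ℤ.- e₀) ≡ windowWeight S w u (+ j ℤ.- e₀)
    agree {N} {u} u-framed j j<N = begin
      windowWeight dropLast Φ u i  ≡⟨ windowWeight-inside dropLast Φ u i lo
                                        (subst (ℤ._≤ + N) (sym atj) (+≤+ (ℕP.<⇒≤ j<N))) ⟩
      Φ (window u i dropLast)      ≡⟨ F-T-window-dropLast g u-framed i gₗ≡0 ⟩
      w (window u i S)             ≡⟨ windowWeight-inside S w u i lo (subst (ℤ._≤ + N) (sym i+e₁≡1+j) (+≤+ j<N)) ⟨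
      windowWeight S w u i         ∎
      where
      i = + j ℤ.- e₀
      atj : i ℤ.+ e₀ ≡ + j
      atj = x-a+a≡x (+ j) e₀
      lo : + 0 ℤ.≤ i ℤ.+ e₀
      lo = subst (+ 0 ℤ.≤_) (sym atj) (+≤+ z≤n)
      i+e₁≡1+j : i ℤ.+ e₁ ≡ + suc j
      i+e₁≡1+j = trans (cong (λ a → i ℤ.+ a) adjacent) (trans (i+suc i e₀) (cong (λ x → + 1 ℤ.+ x) atj))

  reduction : Degenerate g → Reduction S w
  reduction (inj₁ g₀≡0) = headReduction g₀≡0
  reduction (inj₂ gₗ≡0) = tailReduction gₗ≡0

reduction : ∀ S → 2 ℕ.≤ card S → (g : Vec ℕ (card S)) → Degenerate g → Reduction S (λ c → F (T c) g)
reduction record { card-1 = zero } (s≤s ())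
reduction record { card-1 = suc (suc m) ; elt = e ; sorted = e-sorted } _ g =
  WideReductions.reduction e e-sorted g
    (ℤP.≤-<-trans (ℤP.i<j⇒suc[i]≤j (e-sorted Fin.zero (Fin.suc Fin.zero) z<s))
                  (e-sorted (Fin.suc Fin.zero) (fromℕ (suc (suc m))) (s<s z<s)))
reduction record { card-1 = suc zero ; elt = e ; sorted = e-sorted } _ g
  with ℤ.suc (e Fin.zero) ℤ.<? e (Fin.suc Fin.zero)
... | yes wide = WideReductions.reduction e e-sorted g wide
... | no ¬wide = NarrowReductions.reduction e e-sorted g
  (ℤP.≤-antisym (ℤP.≮⇒≥ ¬wide) (ℤP.i<j⇒suc[i]≤j (e-sorted Fin.zero (Fin.suc Fin.zero) z<s)))

deck-reduction : ∀ {N S w} (r : Reduction S w) (u : Vec ℤ (suc N)) → Framed u → Framed (reverse u) →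
  let open Reduction r in (c₀ ℕ.+ c₀) ℕ.+ sum (map w (deck S u)) ≡ sum (map Φ (deck U u))
deck-reduction {S = S} {w} r u u-framed u′-framed = begin
  (c₀ ℕ.+ c₀) ℕ.+ sum (map w (deck S u))
    ≡⟨ cong ((c₀ ℕ.+ c₀) ℕ.+_) (sum-map-deck S w u) ⟩
  (c₀ ℕ.+ c₀) ℕ.+ (windowSum S w u ℕ.+ windowSum S w (reverse u))
    ≡⟨ interchange ℕP.+-commutativeSemigroup c₀ c₀ _ _ ⟩
  (c₀ ℕ.+ windowSum S w u) ℕ.+ (c₀ ℕ.+ windowSum S w (reverse u))
    ≡⟨ cong₂ ℕ._+_ (windowSum-U u u-framed) (windowSum-U (reverse u) u′-framed) ⟨
  windowSum U Φ u ℕ.+ windowSum U Φ (reverse u)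
    ≡⟨ sum-map-deck U Φ u ⟨
  sum (map Φ (deck U u)) ∎
  where open Reduction r

sum-deck-determined : ∀ {N S w} → Reduction S w → {h h̃ : Vec ℤ (suc N)} →
  Framed h → Framed (reverse h) → Framed h̃ → Framed (reverse h̃) →
  (∀ U → U ≺ S → deck U h ↭ deck U h̃) → sum (map w (deck S h)) ≡ sum (map w (deck S h̃))
sum-deck-determined r {h} {h̃} h-framed h′-framed h̃-framed h̃′-framed decks =
  ℕP.+-cancelˡ-≡ (c₀ ℕ.+ c₀) _ _ (begin
    (c₀ ℕ.+ c₀) ℕ.+ _    ≡⟨ deck-reduction r h h-framed h′-framed ⟩
    sum (map Φ (deck U h))  ≡⟨ sum-↭ (PermP.map⁺ Φ (decks U U≺S)) ⟩
    sum (map Φ (deck U h̃))  ≡⟨ deck-reduction r h̃ h̃-framed h̃′-framed ⟨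
    (c₀ ℕ.+ c₀) ℕ.+ _    ∎)
  where open Reduction r

d-map-T : ∀ {s} (M : List (Vec ℤ (suc s))) g → d (map T M) g ≡ sum (map (λ c → F (T c) g) M)
d-map-T M g = cong sum (sym (ListP.map-∘ M))

proposition4p5 : (k : ℕ) → 1 ≤ k →
    (G G̃ : Graph) → IsCaterpillar G → IsCaterpillar G̃ →
    HasDiameter G (suc k) → HasDiameter G̃ (suc k) →
    (p : Path G (suc k)) → IsLongestPath G (suc k) p →
    (p̃ : Path G̃ (suc k)) → IsLongestPath G̃ (suc k) p̃ →
    (S : FinZSet) → (∀ i → (+ 1 Data.Integer.≤ elt S i) × (elt S i Data.Integer.≤ + k)) →
    2 ≤ card S →
    (∀ (U : FinZSet) → U ≺ S →
      deck U (aux k (phi G k p)) ↭ deck U (aux k (phi G̃ k p̃))) →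
    degenPart (d (map T (deck S (aux k (phi G k p)))))
      ≈ₘ degenPart (d (map T (deck S (aux k (phi G̃ k p̃)))))
proposition4p5 k _ G G̃ _ _ _ _ p _ p̃ _ S _ 2≤|S| decks g with degenerate? g
... | no  _            = refl
... | yes g-degenerate = begin
  d (map T (deck S h)) g                   ≡⟨ d-map-T (deck S h) g ⟩
  sum (map (λ c → F (T c) g) (deck S h))   ≡⟨ sum-deck-determined (reduction S 2≤|S| g g-degenerate)
                                                (aux-framed k _) (reverse-aux-framed k _)
                                                (aux-framed k _) (reverse-aux-framed k _) decks ⟩
  sum (map (λ c → F (T c) g) (deck S h̃))   ≡⟨ d-map-T (deck S h̃) g ⟨
  d (map T (deck S h̃)) g                   ∎
  where
  h  = aux k (phi G k p)
  h̃ = aux k (phi G̃ k p̃)
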